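{- Let $P\subseteq\omega$ and let $p_0\ge p_1\ge p_2\ge\cdots$ be a sequence of $\mathbb{C}$-conditions which is 3-generic relative to $P$, and let $f=\bigcup_s\sigma^{p_s}:[\omega]^2\to 2$. Then $f\oplus P$ does not compute any set p-homogeneous for $f$.
   Context: The forcing $\mathbb{C}$: a condition is a triple $p=\langle\sigma^p,l^p,|p|\rangle$ with $|p|\in\omega$, $\sigma^p:[|p|]^2\to 2$ (writing $\sigma^p(x,y)$ for $x<y$), $l^p:|p|\to 2\times\omega$, such that $l^p(x)=\langle i,z\rangle$ implies $\sigma^p(x,y)=i$ whenever $\sigma^p(x,y)$ is defined and $y\ge z$. A condition $q$ extends $p$ ($q\le p$) if $|q|\ge|p|$, $\sigma^q\supseteq\sigma^p$ and $l^q\supseteq l^p$. A descending sequence of conditions is 3-generic relative to $P$ if for every set $W$ of conditions that is $\Sigma^0_3$-definable relative to $P$, either some $p_s\in W$ or some $p_s$ has no extension in $W$. A set $H=H_L\oplus H_R$ (with $H_L,H_R$ infinite) is p-homogeneous for $f$ if $f$ is constant on $\{\{x,y\}:x\in H_L,y\in H_R,x\ne y\}$. -}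

module Defs where

open import Data.Nat using (ℕ; zero; suc; _+_; _≤_; _<_; _≥_)
open import Data.Nat.Properties using (_≟_; _<?_)
open import Data.Bool using (Bool; true; false)
open import Data.Fin using (Fin)
open import Data.Vec using (Vec; []; _∷_; lookup)
open import Data.Product using (Σ; ∃; ∃-syntax; _×_; _,_; proj₁; proj₂)
open import Data.Sum using (_⊎_)
open import Relation.Nullary using (¬_; yes; no)
open import Relation.Binary.PropositionalEquality using (_≡_; _≢_)

b2n : Bool → ℕ
b2n false = 0
b2n true  = 1

tri : ℕ → ℕ
tri zero    = 0
tri (suc k) = suc k + tri k

pair : ℕ → ℕ → ℕ
pair x y = tri (x + y) + y

unpair : ℕ → ℕ × ℕ
unpair zero = 0 , 0
unpair (suc n) with unpair n
... | zero  , y = suc y , 0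
... | suc x , y = x , suc y

-- effective join: (g ⊕ h)(2k) = g k, (g ⊕ h)(2k+1) = h k
join : (ℕ → ℕ) → (ℕ → ℕ) → ℕ → ℕ
join g h zero          = g 0
join g h (suc zero)    = h 0
join g h (suc (suc n)) = join (λ k → g (suc k)) (λ k → h (suc k)) n

χ : (ℕ → Bool) → ℕ → ℕ
χ A n = b2n (A n)

data Code : ℕ → Set where
  Z    : ∀ {n} → Code n
  S    : Code 1
  Proj : ∀ {n} → Fin n → Code n
  Orc  : Code 1
  Comp : ∀ {m n} → Code m → Vec (Code n) m → Code n
  Rec  : ∀ {n} → Code n → Code (suc (suc n)) → Code (suc n)
  Mu   : ∀ {n} → Code (suc n) → Code n

mutual
  data Eval (g : ℕ → ℕ) : ∀ {n} → Code n → Vec ℕ n → ℕ → Set where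
    eZ    : ∀ {n} {xs : Vec ℕ n} → Eval g Z xs 0
    eS    : ∀ {x} → Eval g S (x ∷ []) (suc x)
    eProj : ∀ {n} {i : Fin n} {xs} → Eval g (Proj i) xs (lookup xs i)
    eOrc  : ∀ {x} → Eval g Orc (x ∷ []) (g x)
    eComp : ∀ {m n} {c : Code m} {cs : Vec (Code n) m} {xs ys v} →
            EvalAll g cs xs ys → Eval g c ys v → Eval g (Comp c cs) xs v
    eRec0 : ∀ {n} {b : Code n} {h} {xs v} →
            Eval g b xs v → Eval g (Rec b h) (0 ∷ xs) v
    eRecS : ∀ {n} {b : Code n} {h} {k xs u v} →
            Eval g (Rec b h) (k ∷ xs) u → Eval g h (k ∷ u ∷ xs) v →
            Eval g (Rec b h) (suc k ∷ xs) v
    eMu   : ∀ {n} {c : Code (suc n)} {xs y} →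
            Eval g c (y ∷ xs) 0 →
            (∀ k → k < y → ∃[ m ] Eval g c (k ∷ xs) (suc m)) →
            Eval g (Mu c) xs y

  data EvalAll (g : ℕ → ℕ) {n : ℕ} : ∀ {m} → Vec (Code n) m → Vec ℕ n → Vec ℕ m → Set where
    []  : ∀ {xs} → EvalAll g [] xs []
    _∷_ : ∀ {m} {c} {cs : Vec (Code n) m} {xs v vs} →
          Eval g c xs v → EvalAll g cs xs vs → EvalAll g (c ∷ cs) xs (v ∷ vs)

_≤T_ : (ℕ → Bool) → (ℕ → ℕ) → Set
A ≤T g = ∃[ c ] (∀ n → Eval g c (n ∷ []) (χ A n))

Halts : (ℕ → ℕ) → Code 1 → ℕ → Set
Halts g c x = ∃[ v ] Eval g c (x ∷ []) v

-- Raw condition data of length n: built column by column; adding the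
-- point n supplies σ(x,n) for all x < n and the label l(n).
data Cond : ℕ → Set where
  []    : Cond 0
  _▷_,_ : ∀ {n} → Cond n → Vec Bool n → Bool × ℕ → Cond (suc n)

-- σ(x,y) (meaningful for x < y < n; false otherwise)
sig : ∀ {n} → Cond n → ℕ → ℕ → Bool
sig [] x y = false
sig {suc n} (c ▷ v , l) x y with y ≟ n
... | no  _ = sig c x y
... | yes _ with x <? n
...   | yes x<n = lookup v (Data.Fin.fromℕ< x<n)
...   | no  _   = false

-- l(x) (meaningful for x < n)
lab : ∀ {n} → Cond n → ℕ → Bool × ℕ
lab [] x = false , 0
lab {suc n} (c ▷ v , l) x with x ≟ n
... | yes _ = l
... | no  _ = lab c x

Valid : ∀ {n} → Cond n → Set
Valid {n} c = ∀ x y → x < y → y < n → proj₂ (lab c x) ≤ y →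
              sig c x y ≡ proj₁ (lab c x)

record Condition : Set where
  constructor cond
  field
    len   : ℕ
    raw   : Cond len
    valid : Valid raw
open Condition public

_≼_ : Condition → Condition → Set
q ≼ p = len p ≤ len q
      × (∀ x y → x < y → y < len p → sig (raw q) x y ≡ sig (raw p) x y)
      × (∀ x → x < len p → lab (raw q) x ≡ lab (raw p) x)

codeVec : ∀ {n} → Vec Bool n → ℕ
codeVec []      = 0
codeVec (b ∷ v) = suc (pair (b2n b) (codeVec v))

codeCond : ∀ {n} → Cond n → ℕ
codeCond []                  = 0
codeCond (c ▷ v , (b , z)) = suc (pair (codeCond c) (pair (codeVec v) (pair (b2n b) z)))

code : Condition → ℕ
code p = pair (len p) (codeCond (raw p))

Sigma3 : (ℕ → Bool) → (Condition → Set) → Set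
Sigma3 P W = ∃[ e ] (∀ p → (W p → ∃[ a ] (∀ b → Halts (χ P) e (pair (code p) (pair a b))))
                          × ((∃[ a ] (∀ b → Halts (χ P) e (pair (code p) (pair a b)))) → W p))

Descending : (ℕ → Condition) → Set
Descending ps = ∀ s → ps (suc s) ≼ ps s

ThreeGeneric : (ℕ → Bool) → (ℕ → Condition) → Set₁
ThreeGeneric P ps = ∀ (W : Condition → Set) → Sigma3 P W →
  (∃[ s ] W (ps s)) ⊎ (∃[ s ] (∀ q → q ≼ ps s → ¬ W q))

-- f ⊇ σ^{p_s} for all s  (f x y represents f({x,y}) for x < y)
ExtendsAll : (ℕ → ℕ → Bool) → (ℕ → Condition) → Set
ExtendsAll f ps = ∀ s x y → x < y → y < len (ps s) → f x y ≡ sig (raw (ps s)) x y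

fsym : (ℕ → ℕ → Bool) → ℕ → ℕ → Bool
fsym f x y with x <? y
... | yes _ = f x y
... | no  _ = f y x

-- f as a set of naturals via the Cantor enumeration of pairs
-- (value 0 on the diagonal codes)
fSet : (ℕ → ℕ → Bool) → ℕ → ℕ
fSet f n with unpair n
... | x , y with x ≟ y
...   | yes _ = 0
...   | no  _ = b2n (fsym f x y)

HL HR : (ℕ → Bool) → ℕ → Bool
HL H k = H (k + k)
HR H k = H (suc (k + k))

Infinite : (ℕ → Bool) → Set
Infinite A = ∀ n → ∃[ m ] (n ≤ m × A m ≡ true)

PHomogeneous : (ℕ → ℕ → Bool) → (ℕ → Bool) → Set
PHomogeneous f H = Infinite (HL H) × Infinite (HR H)
  × ∃[ i ] (∀ x y → HL H x ≡ true → HR H y ≡ true → x ≢ y → fsym f x y ≡ i)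

module Submission where

-- Suppose a program c computes from f ⊕ P a set H = H_L ⊕ H_R, homogeneous for f
-- with colour i.  Call a a witness for a condition q if a < |q|, the label of a
-- in q has colour ¬i, and c, run on the part of f recorded in q together with P,
-- puts 2a into H.  Having a witness is Σ⁰₁ in P, so by genericity some p_s either
-- has a witness or has no extension with one.  In the first case a ∈ H_L, and its
-- label forces f(a , y) = ¬i for all large y, against homogeneity at some
-- y ∈ H_R.  In the second case take a ∈ H_L with a ≥ |p_s|: the computation of
-- H(2a) uses only finitely much of f, so a long extension of p_s, relabelled at a
-- with ⟨¬i , length⟩, is an extension of p_s with the witness a.

open import Defs
open import Data.Nat using (ℕ; zero; suc; pred; _+_; _*_; _∸_; _≤_; _<_; z≤n; s≤s; _⊔_)
open import Data.Nat.Properties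
open import Data.Fin using (Fin; zero; suc; fromℕ<; toℕ; inject₁; fromℕ)
open import Data.Fin.Properties using (toℕ-fromℕ<)
open import Data.Bool using (Bool; true; false; not)
open import Data.Bool.Properties using (not-¬)
open import Data.Vec using (Vec; []; _∷_; lookup; tabulate; _∷ʳ_)
open import Data.Vec.Properties using (tabulate∘lookup; lookup∘tabulate; ∷-injective)
open import Data.Product using (∃-syntax; _×_; _,_; proj₁; proj₂)
open import Data.Sum using (_⊎_; inj₁; inj₂)
open import Data.Empty using (⊥; ⊥-elim)
open import Relation.Nullary using (¬_; yes; no)
open import Relation.Binary.PropositionalEquality
open import Relation.Binary.Definitions using (tri<; tri≈; tri>)

mutual
  eval-det : ∀ {g n} {c : Code n} {xs v w} → Eval g c xs v → Eval g c xs w → v ≡ w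
  eval-det eZ eZ = refl
  eval-det eS eS = refl
  eval-det eProj eProj = refl
  eval-det eOrc eOrc = refl
  eval-det (eComp as e) (eComp as' e') with evalAll-det as as'
  ... | refl = eval-det e e'
  eval-det (eRec0 e) (eRec0 e') = eval-det e e'
  eval-det (eRecS e h) (eRecS e' h') with eval-det e e'
  ... | refl = eval-det h h'
  eval-det (eMu {y = y} z pos) (eMu {y = y'} z' pos') with <-cmp y y'
  ... | tri< y<y' _ _ = ⊥-elim (0≢1+n (eval-det z (proj₂ (pos' y y<y'))))
  ... | tri≈ _ y≡y' _ = y≡y'
  ... | tri> _ _ y'<y = ⊥-elim (0≢1+n (eval-det z' (proj₂ (pos y' y'<y))))

  evalAll-det : ∀ {g n m} {cs : Vec (Code n) m} {xs vs ws} →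
                EvalAll g cs xs vs → EvalAll g cs xs ws → vs ≡ ws
  evalAll-det [] [] = refl
  evalAll-det (e ∷ es) (e' ∷ es') = cong₂ _∷_ (eval-det e e') (evalAll-det es es')

plusCode : Code 2
plusCode = Rec (Proj zero) (Comp S (Proj (suc zero) ∷ []))

plus-eval : ∀ {g} a x → Eval g plusCode (a ∷ x ∷ []) (a + x)
plus-eval zero    x = eRec0 eProj
plus-eval (suc a) x = eRecS (plus-eval a x) (eComp (eProj ∷ []) eS)

timesCode : Code 2
timesCode = Rec Z (Comp plusCode (Proj (suc (suc zero)) ∷ Proj (suc zero) ∷ []))

times-eval : ∀ {g} a x → Eval g timesCode (a ∷ x ∷ []) (a * x)
times-eval zero    x = eRec0 eZ
times-eval (suc a) x = eRecS (times-eval a x) (eComp (eProj ∷ eProj ∷ []) (plus-eval x (a * x)))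

predCode : Code 1
predCode = Rec Z (Proj zero)

pred-eval : ∀ {g} a → Eval g predCode (a ∷ []) (pred a)
pred-eval zero    = eRec0 eZ
pred-eval (suc a) = eRecS (pred-eval a) eProj

monusCode : Code 2
monusCode = Rec (Proj zero) (Comp predCode (Proj (suc zero) ∷ []))

monus-eval : ∀ {g} a x → Eval g monusCode (a ∷ x ∷ []) (x ∸ a)
monus-eval zero    x = eRec0 eProj
monus-eval (suc a) x = subst (Eval _ monusCode (suc a ∷ x ∷ [])) (pred[m∸n]≡m∸[1+n] x a)
  (eRecS (monus-eval a x) (eComp (eProj ∷ []) (pred-eval (x ∸ a))))

triCode : Code 1
triCode = Rec Z (Comp plusCode (Comp S (Proj zero ∷ []) ∷ Proj (suc zero) ∷ []))

tri-eval : ∀ {g} a → Eval g triCode (a ∷ []) (tri a)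
tri-eval zero    = eRec0 eZ
tri-eval (suc a) = eRecS (tri-eval a) (eComp (eComp (eProj ∷ []) eS ∷ eProj ∷ []) (plus-eval (suc a) (tri a)))

iter : (ℕ → ℕ) → ℕ → ℕ → ℕ
iter F zero    x = x
iter F (suc k) x = F (iter F k x)

iterCode : Code 1 → Code 2
iterCode F = Rec (Proj zero) (Comp F (Proj (suc zero) ∷ []))

iter-eval : ∀ {g} (F : Code 1) (h : ℕ → ℕ) → (∀ x → Eval g F (x ∷ []) (h x)) →
            ∀ k x → Eval g (iterCode F) (k ∷ x ∷ []) (iter h k x)
iter-eval F h F-eval zero    x = eRec0 eProj
iter-eval F h F-eval (suc k) x = eRecS (iter-eval F h F-eval k x) (eComp (eProj ∷ []) (F-eval (iter h k x)))

projs-eval : ∀ {g m n} (ys : Vec ℕ m) (ρ : Fin n → Fin m) →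
             EvalAll g (tabulate (λ i → Proj (ρ i))) ys (tabulate (λ i → lookup ys (ρ i)))
projs-eval {n = zero}  ys ρ = []
projs-eval {n = suc n} ys ρ = eProj ∷ projs-eval ys (λ i → ρ (suc i))

identity-eval : ∀ {g n} (xs : Vec ℕ n) → EvalAll g (tabulate (λ i → Proj i)) xs xs
identity-eval xs = subst (EvalAll _ _ xs) (tabulate∘lookup xs) (projs-eval xs (λ i → i))

weaken : ∀ {n} → Code n → Code (suc n)
weaken c = Comp c (tabulate (λ i → Proj (suc i)))

drop-eval : ∀ {g n} (xs : Vec ℕ n) y → EvalAll g (tabulate (λ i → Proj (suc i))) (y ∷ xs) xs
drop-eval xs y = subst (EvalAll _ _ (y ∷ xs)) (tabulate∘lookup xs) (projs-eval (y ∷ xs) suc)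

weaken-eval : ∀ {g n} {c : Code n} {xs v} y → Eval g c xs v → Eval g (weaken c) (y ∷ xs) v
weaken-eval y e = eComp (drop-eval _ y) e

weaken-inv : ∀ {g n} {c : Code n} {xs y v} → Eval g (weaken c) (y ∷ xs) v → Eval g c xs v
weaken-inv {xs = xs} {y} (eComp as e) with evalAll-det as (drop-eval xs y)
... | refl = e

search : ℕ → (ℕ → ℕ) → ℕ
search zero    f = zero
search (suc k) f with f 0
... | zero  = zero
... | suc _ = suc (search k (λ y → f (suc y)))

record IsSearch (k : ℕ) (f : ℕ → ℕ) (y : ℕ) : Set where
  field
    bounded  : y ≤ k
    found    : y < k → f y ≡ 0
    positive : ∀ j → j < y → f j ≢ 0

search-spec : ∀ k f → IsSearch k f (search k f)
search-spec zero    f = record { bounded = z≤n ; found = λ () ; positive = λ _ () }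
search-spec (suc k) f with f 0 in f0≡
... | zero  = record { bounded = z≤n ; found = λ _ → f0≡ ; positive = λ _ () }
... | suc _ = record { bounded = s≤s bounded ; found = found-suc ; positive = positive-suc }
  where
  shifted : ℕ → ℕ
  shifted y = f (suc y)
  open IsSearch (search-spec k shifted)
  found-suc : suc (search k shifted) < suc k → f (suc (search k shifted)) ≡ 0
  found-suc (s≤s y<k) = found y<k
  positive-suc : ∀ j → j < suc (search k shifted) → f j ≢ 0
  positive-suc zero    _        f0≡0 = 0≢1+n (trans (sym f0≡0) f0≡)
  positive-suc (suc j) (s≤s j<) = positive j j<

search-unique : ∀ k f y → y < k → f y ≡ 0 → (∀ j → j < y → f j ≢ 0) → search k f ≡ y
search-unique k f y y<k fy≡0 below with <-cmp (search k f) y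
... | tri< s<y _ _ = ⊥-elim (below _ s<y (IsSearch.found (search-spec k f) (<-trans s<y y<k)))
... | tri≈ _ s≡y _ = s≡y
... | tri> _ _ y<s = ⊥-elim (IsSearch.positive (search-spec k f) y y<s fy≡0)

if0 : ℕ → ℕ → ℕ → ℕ
if0 zero    a b = a
if0 (suc _) a b = b

infixl 6 _+ₑ_ _∸ₑ_
data Expr (n : ℕ) : Set where
  var      : Fin n → Expr n
  lit      : ℕ → Expr n
  _+ₑ_     : Expr n → Expr n → Expr n
  _∸ₑ_     : Expr n → Expr n → Expr n
  triangle : Expr n → Expr n
  oracle   : Expr n → Expr n
  iterate  : Expr 1 → Expr n → Expr n → Expr n
  least    : Expr n → Expr (suc n) → Expr n
  apply    : Expr 1 → Expr n → Expr n
  ifZero   : Expr n → Expr n → Expr n → Expr n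

⟦_⟧ : ∀ {n} → Expr n → (ℕ → ℕ) → Vec ℕ n → ℕ
⟦ var i ⟧          g xs = lookup xs i
⟦ lit k ⟧          g xs = k
⟦ a +ₑ b ⟧         g xs = ⟦ a ⟧ g xs + ⟦ b ⟧ g xs
⟦ a ∸ₑ b ⟧         g xs = ⟦ a ⟧ g xs ∸ ⟦ b ⟧ g xs
⟦ triangle a ⟧     g xs = tri (⟦ a ⟧ g xs)
⟦ oracle a ⟧       g xs = g (⟦ a ⟧ g xs)
⟦ iterate F k x ⟧  g xs = iter (λ z → ⟦ F ⟧ g (z ∷ [])) (⟦ k ⟧ g xs) (⟦ x ⟧ g xs)
⟦ least b t ⟧      g xs = search (⟦ b ⟧ g xs) (λ y → ⟦ t ⟧ g (y ∷ xs))
⟦ apply F a ⟧      g xs = ⟦ F ⟧ g (⟦ a ⟧ g xs ∷ [])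
⟦ ifZero c a b ⟧   g xs = if0 (⟦ c ⟧ g xs) (⟦ a ⟧ g xs) (⟦ b ⟧ g xs)

litCode : ∀ {n} → ℕ → Code n
litCode zero    = Z
litCode (suc k) = Comp S (litCode k ∷ [])

lit-eval : ∀ {g n} (xs : Vec ℕ n) k → Eval g (litCode k) xs k
lit-eval xs zero    = eZ
lit-eval xs (suc k) = eComp (lit-eval xs k ∷ []) eS

nonzero-product : ∀ a b → a ≢ 0 → 0 < b → ∃[ m ] a * b ≡ suc m
nonzero-product zero    b       a≢0 _ = ⊥-elim (a≢0 refl)
nonzero-product (suc a) (suc b) _   _ = b + a * suc b , refl

-- Bounded search below b becomes unbounded search for the first zero of
-- t(y) * (b ∸ y), which is reached at y = b at the latest.
searchStep : ∀ {n} → Code n → Code (suc n) → Code (suc n)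
searchStep b t = Comp timesCode (t ∷ Comp monusCode (Proj zero ∷ weaken b ∷ []) ∷ [])

-- Compilation; ifZero becomes a primitive recursion on the test.
compile : ∀ {n} → Expr n → Code n
compile (var i)         = Proj i
compile (lit k)         = litCode k
compile (a +ₑ b)        = Comp plusCode (compile a ∷ compile b ∷ [])
compile (a ∸ₑ b)        = Comp monusCode (compile b ∷ compile a ∷ [])
compile (triangle a)    = Comp triCode (compile a ∷ [])
compile (oracle a)      = Comp Orc (compile a ∷ [])
compile (iterate F k x) = Comp (iterCode (compile F)) (compile k ∷ compile x ∷ [])
compile (least b t)     = Mu (searchStep (compile b) (compile t))
compile (apply F a)     = Comp (compile F) (compile a ∷ [])
compile (ifZero c a b)  = Comp (Rec (compile a) (weaken (weaken (compile b)))) (compile c ∷ tabulate (λ i → Proj i))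

compile-eval : ∀ {g n} (e : Expr n) (xs : Vec ℕ n) → Eval g (compile e) xs (⟦ e ⟧ g xs)
compile-eval (var i)         xs = eProj
compile-eval (lit k)         xs = lit-eval xs k
compile-eval (a +ₑ b)        xs = eComp (compile-eval a xs ∷ compile-eval b xs ∷ []) (plus-eval _ _)
compile-eval (a ∸ₑ b)        xs = eComp (compile-eval b xs ∷ compile-eval a xs ∷ []) (monus-eval _ _)
compile-eval (triangle a)    xs = eComp (compile-eval a xs ∷ []) (tri-eval _)
compile-eval (oracle a)      xs = eComp (compile-eval a xs ∷ []) eOrc
compile-eval (iterate F k x) xs = eComp (compile-eval k xs ∷ compile-eval x xs ∷ [])
  (iter-eval (compile F) _ (λ z → compile-eval F (z ∷ [])) _ _)
compile-eval (apply F a)     xs = eComp (compile-eval a xs ∷ []) (compile-eval F _)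
compile-eval {g} (ifZero c a b) xs = eComp (compile-eval c xs ∷ identity-eval xs) (branch (⟦ c ⟧ g xs))
  where
  branch : ∀ k → Eval g (Rec (compile a) (weaken (weaken (compile b)))) (k ∷ xs) (if0 k (⟦ a ⟧ g xs) (⟦ b ⟧ g xs))
  branch zero    = eRec0 (compile-eval a xs)
  branch (suc k) = eRecS (branch k) (weaken-eval k (weaken-eval _ (compile-eval b xs)))
compile-eval {g} (least b t) xs = eMu stops-at-result positive-before
  where
  B : ℕ
  B = ⟦ b ⟧ g xs
  f : ℕ → ℕ
  f y = ⟦ t ⟧ g (y ∷ xs)
  open IsSearch (search-spec B f)
  step : ∀ y → Eval g (searchStep (compile b) (compile t)) (y ∷ xs) (f y * (B ∸ y))
  step y = eComp (compile-eval t (y ∷ xs) ∷ eComp (eProj ∷ weaken-eval y (compile-eval b xs) ∷ []) (monus-eval y B) ∷ [])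
                 (times-eval _ _)
  zero-product : f (search B f) * (B ∸ search B f) ≡ 0
  zero-product with search B f <? B
  ... | yes Y<B = cong (_* (B ∸ search B f)) (found Y<B)
  ... | no  Y≮B = trans (cong (f (search B f) *_) (m≤n⇒m∸n≡0 (≮⇒≥ Y≮B))) (*-zeroʳ (f (search B f)))
  stops-at-result : Eval g (searchStep (compile b) (compile t)) (search B f ∷ xs) 0
  stops-at-result = subst (Eval g _ (search B f ∷ xs)) zero-product (step (search B f))
  positive-before : ∀ j → j < search B f → ∃[ m ] Eval g (searchStep (compile b) (compile t)) (j ∷ xs) (suc m)
  positive-before j j<Y with nonzero-product (f j) (B ∸ j) (positive j j<Y) (m<n⇒0<n∸m (<-≤-trans j<Y bounded))
  ... | m , eq = m , subst (Eval g _ (j ∷ xs)) eq (step j)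

guarded : ∀ {n} → Expr n → Expr n → Code n
guarded v t = Comp plusCode (compile v ∷ Mu (weaken (compile t)) ∷ [])

guarded-eval : ∀ {g n} (v t : Expr n) xs → ⟦ t ⟧ g xs ≡ 0 → Eval g (guarded v t) xs (⟦ v ⟧ g xs)
guarded-eval {g} v t xs t≡0 = subst (Eval g (guarded v t) xs) (+-identityʳ _)
  (eComp (compile-eval v xs ∷ eMu (subst (Eval g _ (0 ∷ xs)) t≡0 (weaken-eval 0 (compile-eval t xs))) (λ _ ()) ∷ [])
         (plus-eval _ 0))

guarded-halts : ∀ {g n} (v t : Expr n) xs {u} → Eval g (guarded v t) xs u → ⟦ t ⟧ g xs ≡ 0 × u ≡ ⟦ v ⟧ g xs
guarded-halts {g} v t xs (eComp (ev ∷ eMu {y = r} stop pos ∷ []) sum) with eval-det (weaken-inv stop) (compile-eval t xs)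
... | t≡0 with r
...   | suc _ = ⊥-elim (0≢1+n (trans t≡0 (eval-det (compile-eval t xs) (weaken-inv (proj₂ (pos 0 (s≤s z≤n)))))))
...   | zero  = sym t≡0 , trans (eval-det sum (plus-eval _ 0)) (trans (+-identityʳ _) (eval-det ev (compile-eval v xs)))

π₁ π₂ : ℕ → ℕ
π₁ n = proj₁ (unpair n)
π₂ n = proj₂ (unpair n)

pair-suc : ∀ x y → pair x (suc y) ≡ suc (pair (suc x) y)
pair-suc x y = begin
    tri (x + suc y) + suc y    ≡⟨ cong (λ s → tri s + suc y) (+-suc x y) ⟩
    tri (suc (x + y)) + suc y  ≡⟨ +-suc _ y ⟩
    suc (tri (suc x + y) + y)  ∎
  where open ≡-Reasoning

pair-zero : ∀ x → pair (suc x) 0 ≡ suc (pair 0 x)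
pair-zero x = begin
    tri (suc x + 0) + 0  ≡⟨ +-identityʳ _ ⟩
    tri (suc x + 0)      ≡⟨ cong (λ s → tri (suc s)) (+-identityʳ x) ⟩
    suc (x + tri x)      ≡⟨ cong suc (+-comm x (tri x)) ⟩
    suc (tri x + x)      ∎
  where open ≡-Reasoning

unpair-next-diagonal : ∀ n x → unpair n ≡ (0 , x) → unpair (suc n) ≡ (suc x , 0)
unpair-next-diagonal n x eq rewrite eq = refl

unpair-along-diagonal : ∀ n x y → unpair n ≡ (suc x , y) → unpair (suc n) ≡ (x , suc y)
unpair-along-diagonal n x y eq rewrite eq = refl

unpair-pair : ∀ x y → unpair (pair x y) ≡ (x , y)
unpair-pair x y = along (x + y) y x refl
  where
  along : ∀ s y x → x + y ≡ s → unpair (pair x y) ≡ (x , y)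
  along s       zero    zero    _  = refl
  along zero    zero    (suc x) ()
  along (suc s) zero    (suc x) eq = trans (cong unpair (pair-zero x))
    (unpair-next-diagonal (pair 0 x) x (along s x 0 (trans (sym (+-identityʳ x)) (suc-injective eq))))
  along s       (suc y) x       eq = trans (cong unpair (pair-suc x y))
    (unpair-along-diagonal (pair (suc x) y) x y (along s y (suc x) (trans (sym (+-suc x y)) eq)))

π₁-pair : ∀ x y → π₁ (pair x y) ≡ x
π₁-pair x y = cong proj₁ (unpair-pair x y)

π₂-pair : ∀ x y → π₂ (pair x y) ≡ y
π₂-pair x y = cong proj₂ (unpair-pair x y)

pair-unpair : ∀ n → pair (π₁ n) (π₂ n) ≡ n
pair-unpair zero = refl
pair-unpair (suc n) with unpair n | pair-unpair n
... | zero  , y | eq = trans (pair-zero y) (cong suc eq)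
... | suc x , y | eq = trans (pair-suc x y) (cong suc eq)

tri-inflationary : ∀ k → k ≤ tri k
tri-inflationary zero    = z≤n
tri-inflationary (suc k) = s≤s (m≤m+n k (tri k))

tri-mono : ∀ {a b} → a ≤ b → tri a ≤ tri b
tri-mono {zero}              _         = z≤n
tri-mono {suc a} {suc b} (s≤s a≤b) = s≤s (+-mono-≤ a≤b (tri-mono a≤b))

sum≤pair : ∀ x y → x + y ≤ pair x y
sum≤pair x y = ≤-trans (tri-inflationary (x + y)) (m≤m+n _ y)

v₀ : ∀ {n} → Expr (suc n)
v₀ = var zero

v₁ : ∀ {n} → Expr (suc (suc n))
v₁ = var (suc zero)

-- Decoding pairs by expressions: the diagonal index s of n is the least s
-- with n < tri (s + 1); then π₂ n = n ∸ tri s and π₁ n = s ∸ π₂ n.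
diagonal first second : Expr 1
diagonal = least (lit 1 +ₑ v₀) ((lit 1 +ₑ v₁) ∸ₑ triangle (lit 1 +ₑ v₀))
second   = v₀ ∸ₑ triangle diagonal
first    = diagonal ∸ₑ second

diagonal-pair : ∀ g x y → ⟦ diagonal ⟧ g (pair x y ∷ []) ≡ x + y
diagonal-pair g x y = search-unique _ _ (x + y) (s≤s (sum≤pair x y)) reached below
  where
  reached : suc (pair x y) ∸ tri (suc (x + y)) ≡ 0
  reached = m≤n⇒m∸n≡0 (s≤s (subst (_≤ x + y + tri (x + y)) (+-comm y (tri (x + y)))
              (+-monoˡ-≤ (tri (x + y)) (m≤n+m y x))))
  below : ∀ k → k < x + y → suc (pair x y) ∸ tri (suc k) ≢ 0
  below k k< eq = <⇒≱ (s≤s (≤-trans (tri-mono k<) (m≤m+n _ y))) (m∸n≡0⇒m≤n eq)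

second-pair : ∀ g x y → ⟦ second ⟧ g (pair x y ∷ []) ≡ y
second-pair g x y rewrite diagonal-pair g x y = m+n∸m≡n (tri (x + y)) y

first-pair : ∀ g x y → ⟦ first ⟧ g (pair x y ∷ []) ≡ x
first-pair g x y rewrite second-pair g x y | diagonal-pair g x y = m+n∸n≡m x y

first-eval : ∀ g n → ⟦ first ⟧ g (n ∷ []) ≡ π₁ n
first-eval g n = subst (λ m → ⟦ first ⟧ g (m ∷ []) ≡ π₁ n) (pair-unpair n) (first-pair g (π₁ n) (π₂ n))

second-eval : ∀ g n → ⟦ second ⟧ g (n ∷ []) ≡ π₂ n
second-eval g n = subst (λ m → ⟦ second ⟧ g (m ∷ []) ≡ π₂ n) (pair-unpair n) (second-pair g (π₁ n) (π₂ n))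

fstₑ sndₑ : ∀ {n} → Expr n → Expr n
fstₑ a = apply first a
sndₑ a = apply second a

fstₑ-eval : ∀ {g n} (a : Expr n) xs → ⟦ fstₑ a ⟧ g xs ≡ π₁ (⟦ a ⟧ g xs)
fstₑ-eval {g} a xs = first-eval g (⟦ a ⟧ g xs)

sndₑ-eval : ∀ {g n} (a : Expr n) xs → ⟦ sndₑ a ⟧ g xs ≡ π₂ (⟦ a ⟧ g xs)
sndₑ-eval {g} a xs = second-eval g (⟦ a ⟧ g xs)

half : Expr 1
half = least (lit 1 +ₑ v₀) (v₁ ∸ₑ ((v₀ +ₑ v₀) +ₑ lit 1))

half-below : ∀ {m} h → suc h + suc h ≤ m → m ∸ (h + h + 1) ≢ 0
half-below {m} h le eq = <⇒≱ (≤-trans (s≤s (≤-reflexive (trans (+-comm (h + h) 1) (sym (+-suc h h))))) le)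
                                  (m∸n≡0⇒m≤n eq)

half-even : ∀ g k → ⟦ half ⟧ g ((k + k) ∷ []) ≡ k
half-even g k = search-unique _ _ k (s≤s (m≤m+n k k)) (m≤n⇒m∸n≡0 (m≤m+n (k + k) 1))
  (λ h h<k → half-below h (+-mono-≤ h<k h<k))

half-odd : ∀ g k → ⟦ half ⟧ g (suc (k + k) ∷ []) ≡ k
half-odd g k = search-unique _ _ k (s≤s (≤-trans (m≤m+n k k) (n≤1+n _))) (m≤n⇒m∸n≡0 (≤-reflexive (+-comm 1 (k + k))))
  (λ h h<k → half-below h (≤-trans (+-mono-≤ h<k h<k) (n≤1+n _)))

iter-unfold : ∀ (F : ℕ → ℕ) k x → iter F (suc k) x ≡ iter F k (F x)
iter-unfold F zero    x = refl
iter-unfold F (suc k) x = cong F (iter-unfold F k x)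

iter-cong : ∀ {F G : ℕ → ℕ} → (∀ z → F z ≡ G z) → ∀ k x → iter F k x ≡ iter G k x
iter-cong F≗G zero    x = refl
iter-cong {F} {G} F≗G (suc k) x = trans (F≗G _) (cong G (iter-cong F≗G k x))

-- Decoding condition codes.  codeCond (c ▷ v , (b , z)) = 1 + ⟨codeCond c , ⟨codeVec v , ⟨b , z⟩⟩⟩,
-- so the column added at point y is reached by discarding n ∸ (y + 1) later columns.
earlier : ℕ → ℕ
earlier w = π₁ (w ∸ 1)

column : ℕ → ℕ → ℕ → ℕ
column cc n y = π₂ (iter earlier (n ∸ suc y) cc ∸ 1)

-- codeVec (b ∷ v) = 1 + ⟨b , codeVec v⟩: entry x is reached by discarding x heads.
tail : ℕ → ℕ
tail w = π₂ (w ∸ 1)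

entry : ℕ → ℕ → ℕ
entry x cv = π₁ (iter tail x cv ∸ 1)

sigCode : ℕ → ℕ → ℕ → ℕ → ℕ
sigCode cc n x y = entry x (π₁ (column cc n y))

labCode : ℕ → ℕ → ℕ → ℕ
labCode cc n x = π₁ (π₂ (column cc n x))

entry-codeVec : ∀ {n} (v : Vec Bool n) x (x<n : x < n) → entry x (codeVec v) ≡ b2n (lookup v (fromℕ< x<n))
entry-codeVec (b ∷ v) zero    _         = π₁-pair (b2n b) (codeVec v)
entry-codeVec (b ∷ v) (suc x) (s≤s x<n) =
  trans (cong (λ w → π₁ (w ∸ 1)) (trans (iter-unfold tail x (codeVec (b ∷ v)))
                                    (cong (iter tail x) (π₂-pair (b2n b) (codeVec v)))))
        (entry-codeVec v x x<n)

column-earlier : ∀ {n} (c : Cond n) v l y → y < n → column (codeCond (c ▷ v , l)) (suc n) y ≡ column (codeCond c) n y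
column-earlier {n} c v (b , z) y y<n = cong (λ w → π₂ (w ∸ 1)) (begin
    iter earlier (suc n ∸ suc y) cc        ≡⟨ cong (λ k → iter earlier k cc) (+-∸-assoc 1 y<n) ⟩
    iter earlier (suc (n ∸ suc y)) cc      ≡⟨ iter-unfold earlier (n ∸ suc y) cc ⟩
    iter earlier (n ∸ suc y) (earlier cc)  ≡⟨ cong (iter earlier (n ∸ suc y)) (π₁-pair (codeCond c) (pair (codeVec v) (pair (b2n b) z))) ⟩
    iter earlier (n ∸ suc y) (codeCond c)  ∎)
  where
  open ≡-Reasoning
  cc : ℕ
  cc = codeCond (c ▷ v , (b , z))

column-last : ∀ {n} (c : Cond n) v b z → column (codeCond (c ▷ v , (b , z))) (suc n) n ≡ pair (codeVec v) (pair (b2n b) z)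
column-last {n} c v b z rewrite n∸n≡0 n = π₂-pair (codeCond c) _

sigCode-correct : ∀ {n} (c : Cond n) x y → x < y → y < n → sigCode (codeCond c) n x y ≡ b2n (sig c x y)
sigCode-correct {suc n} (c ▷ v , (b , z)) x y x<y y<sn with y ≟ n
... | no y≢n = trans (cong (λ w → entry x (π₁ w)) (column-earlier c v (b , z) y y<n)) (sigCode-correct c x y x<y y<n)
  where
  y<n : y < n
  y<n = ≤∧≢⇒< (≤-pred y<sn) y≢n
... | yes refl with x <? y
...   | no x≮y  = ⊥-elim (x≮y x<y)
...   | yes x<y' = trans (cong (λ w → entry x (π₁ w)) (column-last c v b z))
                   (trans (cong (entry x) (π₁-pair (codeVec v) _)) (entry-codeVec v x x<y'))

labCode-correct : ∀ {n} (c : Cond n) x → x < n → labCode (codeCond c) n x ≡ b2n (proj₁ (lab c x))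
labCode-correct {suc n} (c ▷ v , (b , z)) x x<sn with x ≟ n
... | no x≢n = trans (cong (λ w → π₁ (π₂ w)) (column-earlier c v (b , z) x x<n)) (labCode-correct c x x<n)
  where
  x<n : x < n
  x<n = ≤∧≢⇒< (≤-pred x<sn) x≢n
... | yes refl = trans (cong (λ w → π₁ (π₂ w)) (column-last c v b z))
                 (trans (cong π₁ (π₂-pair (codeVec v) _)) (π₁-pair (b2n b) z))

columnₑ : ∀ {n} → Expr n → Expr n → Expr n → Expr n
columnₑ cc m y = sndₑ (iterate (fstₑ (v₀ ∸ₑ lit 1)) (m ∸ₑ (lit 1 +ₑ y)) cc ∸ₑ lit 1)

entryₑ : ∀ {n} → Expr n → Expr n → Expr n
entryₑ x cv = fstₑ (iterate (sndₑ (v₀ ∸ₑ lit 1)) x cv ∸ₑ lit 1)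

sigₑ : ∀ {n} → Expr n → Expr n → Expr n → Expr n → Expr n
sigₑ cc m x y = entryₑ x (fstₑ (columnₑ cc m y))

labₑ : ∀ {n} → Expr n → Expr n → Expr n → Expr n
labₑ cc m x = fstₑ (sndₑ (columnₑ cc m x))

columnₑ-eval : ∀ {g n} (cc m y : Expr n) xs →
               ⟦ columnₑ cc m y ⟧ g xs ≡ column (⟦ cc ⟧ g xs) (⟦ m ⟧ g xs) (⟦ y ⟧ g xs)
columnₑ-eval {g} cc m y xs = trans (sndₑ-eval (iterate (fstₑ (v₀ ∸ₑ lit 1)) (m ∸ₑ (lit 1 +ₑ y)) cc ∸ₑ lit 1) xs)
  (cong (λ w → π₂ (w ∸ 1)) (iter-cong (λ z → first-eval g (z ∸ 1)) (⟦ m ⟧ g xs ∸ suc (⟦ y ⟧ g xs)) (⟦ cc ⟧ g xs)))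

entryₑ-eval : ∀ {g n} (x cv : Expr n) xs → ⟦ entryₑ x cv ⟧ g xs ≡ entry (⟦ x ⟧ g xs) (⟦ cv ⟧ g xs)
entryₑ-eval {g} x cv xs = trans (fstₑ-eval (iterate (sndₑ (v₀ ∸ₑ lit 1)) x cv ∸ₑ lit 1) xs)
  (cong (λ w → π₁ (w ∸ 1)) (iter-cong (λ z → second-eval g (z ∸ 1)) (⟦ x ⟧ g xs) (⟦ cv ⟧ g xs)))

sigₑ-eval : ∀ {g n} (cc m x y : Expr n) xs →
            ⟦ sigₑ cc m x y ⟧ g xs ≡ sigCode (⟦ cc ⟧ g xs) (⟦ m ⟧ g xs) (⟦ x ⟧ g xs) (⟦ y ⟧ g xs)
sigₑ-eval {g} cc m x y xs = trans (entryₑ-eval x (fstₑ (columnₑ cc m y)) xs)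
  (cong (entry (⟦ x ⟧ g xs)) (trans (fstₑ-eval (columnₑ cc m y) xs) (cong π₁ (columnₑ-eval cc m y xs))))

labₑ-eval : ∀ {g n} (cc m x : Expr n) xs →
            ⟦ labₑ cc m x ⟧ g xs ≡ labCode (⟦ cc ⟧ g xs) (⟦ m ⟧ g xs) (⟦ x ⟧ g xs)
labₑ-eval {g} cc m x xs = trans (fstₑ-eval (sndₑ (columnₑ cc m x)) xs)
  (cong π₁ (trans (sndₑ-eval (columnₑ cc m x) xs) (cong π₂ (columnₑ-eval cc m x xs))))

parity : ∀ m → ∃[ k ] (m ≡ k + k ⊎ m ≡ suc (k + k))
parity zero = 0 , inj₁ refl
parity (suc m) with parity m
... | k , inj₁ refl = k , inj₂ refl
... | k , inj₂ refl = suc k , inj₁ (cong suc (sym (+-suc k k)))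

join-even : ∀ g h k → join g h (k + k) ≡ g k
join-even g h zero    = refl
join-even g h (suc k) rewrite +-suc k k = join-even (λ z → g (suc z)) (λ z → h (suc z)) k

join-odd : ∀ g h k → join g h (suc (k + k)) ≡ h k
join-odd g h zero    = refl
join-odd g h (suc k) rewrite +-suc k k = join-odd (λ z → g (suc z)) (λ z → h (suc z)) k

pairColour : (ℕ → ℕ → Bool) → ℕ → ℕ → ℕ
pairColour f a b with a ≟ b
... | yes _ = 0
... | no  _ = b2n (fsym f a b)

fSet-unpair : ∀ f k → fSet f k ≡ pairColour f (π₁ k) (π₂ k)
fSet-unpair f k with unpair k
... | a , b with a ≟ b
...   | yes _ = refl
...   | no  _ = refl

fsym-< : ∀ f {x y} → x < y → fsym f x y ≡ f x y
fsym-< f {x} {y} x<y with x <? y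
... | yes _   = refl
... | no  x≮y = ⊥-elim (x≮y x<y)

fsym-> : ∀ f {x y} → y < x → fsym f x y ≡ f y x
fsym-> f {x} {y} y<x with x <? y
... | yes x<y = ⊥-elim (<-asym x<y y<x)
... | no  _   = refl

Agrees : (ℕ → ℕ → Bool) → Condition → Set
Agrees f q = ∀ x y → x < y → y < len q → f x y ≡ sig (raw q) x y

if0-pos : ∀ {c} x y → 0 < c → if0 c x y ≡ y
if0-pos x y (s≤s _) = refl

decodedColour : ℕ → ℕ → ℕ → ℕ → ℕ
decodedColour cc n a b = if0 (b ∸ a) (if0 (a ∸ b) 0 (sigCode cc n b a)) (sigCode cc n a b)

sigCode-agrees : ∀ f q {x y} → Agrees f q → x < y → y < len q →
                 sigCode (codeCond (raw q)) (len q) x y ≡ b2n (f x y)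
sigCode-agrees f q {x} {y} agrees x<y y<len =
  trans (sigCode-correct (raw q) x y x<y y<len) (cong b2n (sym (agrees x y x<y y<len)))

decodedColour-correct : ∀ f q a b → Agrees f q → a + b < len q →
                        decodedColour (codeCond (raw q)) (len q) a b ≡ pairColour f a b
decodedColour-correct f q a b agrees a+b<len with a ≟ b | <-cmp a b
... | yes refl | _ rewrite n∸n≡0 a = refl
... | no a≢b | tri≈ _ a≡b _ = ⊥-elim (a≢b a≡b)
... | no _   | tri< a<b _ _ =
  trans (if0-pos _ _ (m<n⇒0<n∸m a<b))
        (trans (sigCode-agrees f q agrees a<b (≤-<-trans (m≤n+m b a) a+b<len)) (cong b2n (sym (fsym-< f a<b))))
... | no _   | tri> _ _ b<a rewrite m≤n⇒m∸n≡0 (<⇒≤ b<a) =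
  trans (if0-pos _ _ (m<n⇒0<n∸m b<a))
        (trans (sigCode-agrees f q agrees b<a (≤-<-trans (m≤m+n a b) a+b<len)) (cong b2n (sym (fsym-> f b<a))))

-- The finite oracle: on input (m , code q) it computes (fSet f ⊕ g)(m) from the
-- colours recorded in q and from the oracle g, halting on even m = 2⟨a , b⟩ only
-- when a + b < len q.
halfₑ parityₑ aₑ bₑ lenₑ ccₑ colourₑ valueₑ rangeₑ : Expr 2
halfₑ   = apply half v₀
parityₑ = v₀ ∸ₑ (halfₑ +ₑ halfₑ)
aₑ      = fstₑ halfₑ
bₑ      = sndₑ halfₑ
lenₑ    = fstₑ v₁
ccₑ     = sndₑ v₁
colourₑ = ifZero (bₑ ∸ₑ aₑ) (ifZero (aₑ ∸ₑ bₑ) (lit 0) (sigₑ ccₑ lenₑ bₑ aₑ)) (sigₑ ccₑ lenₑ aₑ bₑ)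
valueₑ  = ifZero parityₑ colourₑ (oracle halfₑ)
rangeₑ  = ifZero parityₑ ((lit 1 +ₑ (aₑ +ₑ bₑ)) ∸ₑ lenₑ) (lit 0)

finiteOracle : Code 2
finiteOracle = guarded valueₑ rangeₑ

module _ (g : ℕ → ℕ) (k : ℕ) (q : Condition) where
  private
    even odd : Vec ℕ 2
    even = k + k ∷ code q ∷ []
    odd  = suc (k + k) ∷ code q ∷ []

  len-decoded : ∀ xs → ⟦ lenₑ ⟧ g (xs ∷ code q ∷ []) ≡ len q
  len-decoded xs = trans (first-eval g (code q)) (π₁-pair (len q) (codeCond (raw q)))

  cc-decoded : ∀ xs → ⟦ ccₑ ⟧ g (xs ∷ code q ∷ []) ≡ codeCond (raw q)
  cc-decoded xs = trans (second-eval g (code q)) (π₂-pair (len q) (codeCond (raw q)))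

  parity-even : ⟦ parityₑ ⟧ g even ≡ 0
  parity-even rewrite half-even g k = n∸n≡0 (k + k)

  parity-odd : ⟦ parityₑ ⟧ g odd ≡ 1
  parity-odd rewrite half-odd g k = m+n∸n≡m 1 (k + k)

  a-even : ⟦ aₑ ⟧ g even ≡ π₁ k
  a-even = trans (fstₑ-eval {g} halfₑ even) (cong π₁ (half-even g k))

  b-even : ⟦ bₑ ⟧ g even ≡ π₂ k
  b-even = trans (sndₑ-eval {g} halfₑ even) (cong π₂ (half-even g k))

  colour-decoded : ∀ xs → ⟦ colourₑ ⟧ g xs ≡ decodedColour (⟦ ccₑ ⟧ g xs) (⟦ lenₑ ⟧ g xs) (⟦ aₑ ⟧ g xs) (⟦ bₑ ⟧ g xs)
  colour-decoded xs = cong₂ (λ s t → if0 (⟦ bₑ ⟧ g xs ∸ ⟦ aₑ ⟧ g xs) (if0 (⟦ aₑ ⟧ g xs ∸ ⟦ bₑ ⟧ g xs) 0 s) t)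
                            (sigₑ-eval {g} ccₑ lenₑ bₑ aₑ xs) (sigₑ-eval {g} ccₑ lenₑ aₑ bₑ xs)

  value-even : ⟦ valueₑ ⟧ g even ≡ decodedColour (codeCond (raw q)) (len q) (π₁ k) (π₂ k)
  value-even = begin
    ⟦ valueₑ ⟧ g even   ≡⟨ cong (λ p → if0 p (⟦ colourₑ ⟧ g even) (⟦ oracle halfₑ ⟧ g even)) parity-even ⟩
    ⟦ colourₑ ⟧ g even  ≡⟨ colour-decoded even ⟩
    decodedColour (⟦ ccₑ ⟧ g even) (⟦ lenₑ ⟧ g even) (⟦ aₑ ⟧ g even) (⟦ bₑ ⟧ g even)
      ≡⟨ cong₂ (λ c n → decodedColour c n (⟦ aₑ ⟧ g even) (⟦ bₑ ⟧ g even)) (cc-decoded (k + k)) (len-decoded (k + k)) ⟩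
    decodedColour (codeCond (raw q)) (len q) (⟦ aₑ ⟧ g even) (⟦ bₑ ⟧ g even)
      ≡⟨ cong₂ (decodedColour (codeCond (raw q)) (len q)) a-even b-even ⟩
    decodedColour (codeCond (raw q)) (len q) (π₁ k) (π₂ k) ∎
    where open ≡-Reasoning

  range-even : ⟦ rangeₑ ⟧ g even ≡ suc (π₁ k + π₂ k) ∸ len q
  range-even = begin
    ⟦ rangeₑ ⟧ g even   ≡⟨ cong (λ p → if0 p (⟦ (lit 1 +ₑ (aₑ +ₑ bₑ)) ∸ₑ lenₑ ⟧ g even) 0) parity-even ⟩
    suc (⟦ aₑ ⟧ g even + ⟦ bₑ ⟧ g even) ∸ ⟦ lenₑ ⟧ g even
      ≡⟨ cong₂ (λ a b → suc (a + b) ∸ ⟦ lenₑ ⟧ g even) a-even b-even ⟩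
    suc (π₁ k + π₂ k) ∸ ⟦ lenₑ ⟧ g even ≡⟨ cong (suc (π₁ k + π₂ k) ∸_) (len-decoded (k + k)) ⟩
    suc (π₁ k + π₂ k) ∸ len q ∎
    where open ≡-Reasoning

  value-odd : ⟦ valueₑ ⟧ g odd ≡ g k
  value-odd = trans (cong (λ p → if0 p (⟦ colourₑ ⟧ g odd) (⟦ oracle halfₑ ⟧ g odd)) parity-odd) (cong g (half-odd g k))

  range-odd : ⟦ rangeₑ ⟧ g odd ≡ 0
  range-odd = cong (λ p → if0 p (⟦ (lit 1 +ₑ (aₑ +ₑ bₑ)) ∸ₑ lenₑ ⟧ g odd) 0) parity-odd

value-even-correct : ∀ g f q k → Agrees f q → π₁ k + π₂ k < len q →
                     ⟦ valueₑ ⟧ g (k + k ∷ code q ∷ []) ≡ join (fSet f) g (k + k)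
value-even-correct g f q k agrees a+b<len = begin
  ⟦ valueₑ ⟧ g (k + k ∷ code q ∷ [])                        ≡⟨ value-even g k q ⟩
  decodedColour (codeCond (raw q)) (len q) (π₁ k) (π₂ k)  ≡⟨ decodedColour-correct f q (π₁ k) (π₂ k) agrees a+b<len ⟩
  pairColour f (π₁ k) (π₂ k)                              ≡⟨ sym (fSet-unpair f k) ⟩
  fSet f k                                                ≡⟨ sym (join-even (fSet f) g k) ⟩
  join (fSet f) g (k + k)                                 ∎
  where open ≡-Reasoning

finiteOracle-sound : ∀ g f q → Agrees f q → ∀ m {u} →
                     Eval g finiteOracle (m ∷ code q ∷ []) u → u ≡ join (fSet f) g m
finiteOracle-sound g f q agrees m run with guarded-halts valueₑ rangeₑ (m ∷ code q ∷ []) run | parity m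
... | in-range , u≡value | k , inj₁ refl = trans u≡value (value-even-correct g f q k agrees a+b<len)
  where
  a+b<len : π₁ k + π₂ k < len q
  a+b<len = m∸n≡0⇒m≤n (trans (sym (range-even g k q)) in-range)
... | _        , u≡value | k , inj₂ refl = trans u≡value (trans (value-odd g k q) (sym (join-odd (fSet f) g k)))

finiteOracle-complete : ∀ g f q → Agrees f q → ∀ m → m < len q →
                        Eval g finiteOracle (m ∷ code q ∷ []) (join (fSet f) g m)
finiteOracle-complete g f q agrees m m<len with parity m
... | k , inj₁ refl = subst (Eval g finiteOracle (k + k ∷ code q ∷ [])) (value-even-correct g f q k agrees a+b<len)
                        (guarded-eval valueₑ rangeₑ _ (trans (range-even g k q) (m≤n⇒m∸n≡0 a+b<len)))
  where
  a+b<len : π₁ k + π₂ k < len q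
  a+b<len = ≤-<-trans (subst (π₁ k + π₂ k ≤_) (pair-unpair k) (sum≤pair (π₁ k) (π₂ k)))
                      (≤-<-trans (m≤m+n k k) m<len)
... | k , inj₂ refl = subst (Eval g finiteOracle (suc (k + k) ∷ code q ∷ []))
                        (trans (value-odd g k q) (sym (join-odd (fSet f) g k)))
                        (guarded-eval valueₑ rangeₑ _ (range-odd g k q))

lookup-inject₁ : ∀ {n} (xs : Vec ℕ n) k i → lookup (xs ∷ʳ k) (inject₁ i) ≡ lookup xs i
lookup-inject₁ (x ∷ xs) k zero    = refl
lookup-inject₁ (x ∷ xs) k (suc i) = lookup-inject₁ xs k i

lookup-last : ∀ {n} (xs : Vec ℕ n) k → lookup (xs ∷ʳ k) (fromℕ n) ≡ k
lookup-last []       k = refl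
lookup-last (x ∷ xs) k = lookup-last xs k

-- Relativisation of programs: every oracle query x is replaced by a call of the
-- program O on (x , k), where k is a new last argument.  This is how a program
-- run with the oracle f ⊕ P is simulated with the oracle P from the code k of a
-- condition.
module Relativise (O : Code 2) where
  mutual
    relativise : ∀ {n} → Code n → Code (suc n)
    relativise Z                   = Z
    relativise S                   = Comp S (Proj zero ∷ [])
    relativise (Proj i)            = Proj (inject₁ i)
    relativise Orc                 = Comp O (Proj zero ∷ Proj (suc zero) ∷ [])
    relativise (Comp {n = n} c cs) = Comp (relativise c) (relativiseAll cs ∷ʳ Proj (fromℕ n))
    relativise (Rec b h)           = Rec (relativise b) (relativise h)
    relativise (Mu c)              = Mu (relativise c)

    relativiseAll : ∀ {n m} → Vec (Code n) m → Vec (Code (suc n)) m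
    relativiseAll []       = []
    relativiseAll (c ∷ cs) = relativise c ∷ relativiseAll cs

  module Soundness (h G : ℕ → ℕ) (k : ℕ) (O-sound : ∀ m {u} → Eval h O (m ∷ k ∷ []) u → u ≡ G m) where
    mutual
      sound : ∀ {n} (c : Code n) {ys v} → Eval h (relativise c) ys v → ∀ xs → ys ≡ xs ∷ʳ k → Eval G c xs v
      sound Z    eZ                              xs       eq   = eZ
      sound S    (eComp (eProj ∷ []) eS)         (x ∷ []) refl = eS
      sound (Proj i) eProj                       xs       refl = subst (Eval G (Proj i) xs) (sym (lookup-inject₁ xs k i)) eProj
      sound Orc  (eComp (eProj ∷ eProj ∷ []) e) (x ∷ []) refl = subst (Eval G Orc (x ∷ [])) (sym (O-sound x e)) eOrc
      sound (Comp c cs) (eComp es e) xs refl with soundAll cs es xs refl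
      ... | ws , refl , es' = eComp es' (sound c e ws refl)
      sound (Rec b r) (eRec0 e) (x ∷ xs) eq with ∷-injective eq
      ... | refl , eq' = eRec0 (sound b e xs eq')
      sound (Rec b r) (eRecS {k = j} {u = u} e₁ e₂) (x ∷ xs) eq with ∷-injective eq
      ... | refl , eq' = eRecS (sound (Rec b r) e₁ (j ∷ xs) (cong (j ∷_) eq'))
                               (sound r e₂ (j ∷ u ∷ xs) (cong (λ zs → j ∷ u ∷ zs) eq'))
      sound (Mu c) (eMu e₀ pos) xs refl =
        eMu (sound c e₀ (_ ∷ xs) refl) (λ j j< → proj₁ (pos j j<) , sound c (proj₂ (pos j j<)) (j ∷ xs) refl)

      soundAll : ∀ {n m} (cs : Vec (Code n) m) {ys zs} → EvalAll h (relativiseAll cs ∷ʳ Proj (fromℕ n)) ys zs →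
                 ∀ xs → ys ≡ xs ∷ʳ k → ∃[ ws ] (zs ≡ ws ∷ʳ k × EvalAll G cs xs ws)
      soundAll []       (eProj ∷ []) xs refl = [] , cong (_∷ []) (lookup-last xs k) , []
      soundAll (c ∷ cs) (e ∷ es)     xs refl with soundAll cs es xs refl
      ... | ws , refl , es' = _ ∷ ws , refl , sound c e xs refl ∷ es'

  -- The use principle: a halting computation with oracle G queries only finitely
  -- many values, so it is reproduced from any k for which O answers correctly
  -- below some bound N.
  module Use (h G : ℕ → ℕ) where
    AnswersBelow : ℕ → ℕ → Set
    AnswersBelow k N = ∀ m → m < N → Eval h O (m ∷ k ∷ []) (G m)

    answersˡ : ∀ {k a b} → AnswersBelow k (a ⊔ b) → AnswersBelow k a
    answersˡ {a = a} {b} ans m m< = ans m (≤-trans m< (m≤m⊔n a b))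

    answersʳ : ∀ {k a b} → AnswersBelow k (a ⊔ b) → AnswersBelow k b
    answersʳ {a = a} {b} ans m m< = ans m (≤-trans m< (m≤n⊔m a b))

    snocAll : ∀ {n m} {cs : Vec (Code n) m} {c xs vs v} → EvalAll h cs xs vs → Eval h c xs v →
              EvalAll h (cs ∷ʳ c) xs (vs ∷ʳ v)
    snocAll []       e = e ∷ []
    snocAll (e' ∷ es) e = e' ∷ snocAll es e

    mutual
      use : ∀ {n} {c : Code n} {xs v} → Eval G c xs v →
            ∃[ N ] (∀ k → AnswersBelow k N → Eval h (relativise c) (xs ∷ʳ k) v)
      use eZ = 0 , λ _ _ → eZ
      use eS = 0 , λ _ _ → eComp (eProj ∷ []) eS
      use (eProj {i = i} {xs}) = 0 , λ k _ → subst (Eval h (relativise (Proj i)) (xs ∷ʳ k)) (lookup-inject₁ xs k i) eProj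
      use (eOrc {x}) = suc x , λ k ans → eComp (eProj ∷ eProj ∷ []) (ans x ≤-refl)
      use (eComp {n = n} {xs = xs} es e) with useAll es | use e
      ... | N₁ , run₁ | N₂ , run₂ = N₁ ⊔ N₂ , λ k ans →
        eComp (snocAll (run₁ k (answersˡ ans)) (subst (Eval h (Proj (fromℕ n)) (xs ∷ʳ k)) (lookup-last xs k) eProj))
              (run₂ k (answersʳ ans))
      use (eRec0 e) with use e
      ... | N , run = N , λ k ans → eRec0 (run k ans)
      use (eRecS e₁ e₂) with use e₁ | use e₂
      ... | N₁ , run₁ | N₂ , run₂ = N₁ ⊔ N₂ , λ k ans → eRecS (run₁ k (answersˡ ans)) (run₂ k (answersʳ ans))
      use (eMu {y = y} e₀ pos) with use e₀ | useBelow y pos y ≤-refl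
      ... | N₀ , run₀ | N₁ , run₁ = N₀ ⊔ N₁ , λ k ans → eMu (run₀ k (answersˡ ans)) (λ j j< → run₁ j j< k (answersʳ ans))

      useBelow : ∀ {n} {c : Code (suc n)} {xs} y → (∀ j → j < y → ∃[ m ] Eval G c (j ∷ xs) (suc m)) →
                 ∀ y' → y' ≤ y → ∃[ N ] (∀ j → j < y' → ∀ k → AnswersBelow k N →
                                          ∃[ m ] Eval h (relativise c) (j ∷ (xs ∷ʳ k)) (suc m))
      useBelow y pos zero    _  = 0 , λ j ()
      useBelow {c = c} {xs} y pos (suc y') y'<y with useBelow y pos y' (≤-trans (n≤1+n y') y'<y) | use (proj₂ (pos y' y'<y))
      ... | N₁ , run₁ | N₂ , run₂ = N₁ ⊔ N₂ , step
        where
        step : ∀ j → j < suc y' → ∀ k → AnswersBelow k (N₁ ⊔ N₂) → ∃[ m ] Eval h (relativise c) (j ∷ (xs ∷ʳ k)) (suc m)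
        step j (s≤s j≤y') k ans with m≤n⇒m<n∨m≡n j≤y'
        ... | inj₁ j<y' = run₁ j j<y' k (answersˡ ans)
        ... | inj₂ refl = proj₁ (pos y' y'<y) , run₂ k (answersʳ ans)

      useAll : ∀ {n m} {cs : Vec (Code n) m} {xs vs} → EvalAll G cs xs vs →
               ∃[ N ] (∀ k → AnswersBelow k N → EvalAll h (relativiseAll cs) (xs ∷ʳ k) vs)
      useAll [] = 0 , λ _ _ → []
      useAll (e ∷ es) with use e | useAll es
      ... | N₁ , run₁ | N₂ , run₂ = N₁ ⊔ N₂ , λ k ans → run₁ k (answersˡ ans) ∷ run₂ k (answersʳ ans)

sig-earlier : ∀ {n} (c : Cond n) v l x y → y ≢ n → sig (c ▷ v , l) x y ≡ sig c x y
sig-earlier {n} c v l x y y≢n with y ≟ n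
... | yes y≡n = ⊥-elim (y≢n y≡n)
... | no  _   = refl

sig-last : ∀ {n} (c : Cond n) v l x (x<n : x < n) → sig (c ▷ v , l) x n ≡ lookup v (fromℕ< x<n)
sig-last {n} c v l x x<n with n ≟ n
... | no n≢n = ⊥-elim (n≢n refl)
... | yes _ with x <? n
...   | yes _   = refl
...   | no  x≮n = ⊥-elim (x≮n x<n)

lab-earlier : ∀ {n} (c : Cond n) v l x → x ≢ n → lab (c ▷ v , l) x ≡ lab c x
lab-earlier {n} c v l x x≢n with x ≟ n
... | yes x≡n = ⊥-elim (x≢n x≡n)
... | no  _   = refl

≼-refl : ∀ p → p ≼ p
≼-refl p = ≤-refl , (λ _ _ _ _ → refl) , (λ _ _ → refl)

≼-trans : ∀ {r q p} → r ≼ q → q ≼ p → r ≼ p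
≼-trans (len₁ , sig₁ , lab₁) (len₂ , sig₂ , lab₂) =
  ≤-trans len₂ len₁ ,
  (λ x y x<y y< → trans (sig₁ x y x<y (<-≤-trans y< len₂)) (sig₂ x y x<y y<)) ,
  (λ x x< → trans (lab₁ x (<-≤-trans x< len₂)) (lab₂ x x<))

-- One more point n: colour each pair {x , n} by the colour promised by the
-- label of x, so every label stays respected; n gets the void label (false , 0).
labelColours : ∀ {n} → Cond n → Vec Bool n
labelColours c = tabulate (λ x → proj₁ (lab c (toℕ x)))

extendOnce : Condition → Condition
extendOnce (cond n c valid-c) = cond (suc n) c' valid-c'
  where
  c' : Cond (suc n)
  c' = c ▷ labelColours c , (false , 0)
  valid-c' : Valid c'
  valid-c' x y x<y y<sn z≤y with m≤n⇒m<n∨m≡n (≤-pred y<sn)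
  ... | inj₂ refl = begin
    sig c' x n                            ≡⟨ sig-last c (labelColours c) (false , 0) x x<y ⟩
    lookup (labelColours c) (fromℕ< x<y)  ≡⟨ lookup∘tabulate _ (fromℕ< x<y) ⟩
    proj₁ (lab c (toℕ (fromℕ< x<y)))      ≡⟨ cong (λ z → proj₁ (lab c z)) (toℕ-fromℕ< x<y) ⟩
    proj₁ (lab c x)                       ≡⟨ cong proj₁ (sym (lab-earlier c (labelColours c) (false , 0) x (<⇒≢ x<y))) ⟩
    proj₁ (lab c' x)                      ∎
    where open ≡-Reasoning
  ... | inj₁ y<n = trans (sig-earlier c (labelColours c) (false , 0) x y (<⇒≢ y<n))
                   (trans (valid-c x y x<y y<n (subst (λ l → proj₂ l ≤ y) lab-x z≤y)) (cong proj₁ (sym lab-x)))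
    where
    lab-x : lab c' x ≡ lab c x
    lab-x = lab-earlier c (labelColours c) (false , 0) x (<⇒≢ (<-trans x<y y<n))

extendOnce-≼ : ∀ p → extendOnce p ≼ p
extendOnce-≼ (cond n c _) = n≤1+n n ,
  (λ x y _ y<n → sig-earlier c (labelColours c) (false , 0) x y (<⇒≢ y<n)) ,
  (λ x x<n → lab-earlier c (labelColours c) (false , 0) x (<⇒≢ x<n))

lengthen : ∀ N p → ∃[ q ] (q ≼ p × N ≤ len q)
lengthen zero    p = p , ≼-refl p , z≤n
lengthen (suc N) p with lengthen N p
... | q , q≼p , N≤ = extendOnce q , ≼-trans {extendOnce q} {q} {p} (extendOnce-≼ q) q≼p , s≤s N≤

setLabel : ∀ {n} → Cond n → ℕ → Bool × ℕ → Cond n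
setLabel []                a l = []
setLabel {suc n} (c ▷ v , l₀) a l with a ≟ n
... | yes _ = c ▷ v , l
... | no  _ = setLabel c a l ▷ v , l₀

setLabel-sig : ∀ {n} (c : Cond n) a l x y → sig (setLabel c a l) x y ≡ sig c x y
setLabel-sig []                a l x y = refl
setLabel-sig {suc n} (c ▷ v , l₀) a l x y with a ≟ n
... | yes _ with y ≟ n
...   | yes _ = refl
...   | no  _ = refl
setLabel-sig {suc n} (c ▷ v , l₀) a l x y | no _ with y ≟ n
...   | yes _ = refl
...   | no  _ = setLabel-sig c a l x y

setLabel-other : ∀ {n} (c : Cond n) a l x → x ≢ a → lab (setLabel c a l) x ≡ lab c x
setLabel-other []                a l x x≢a = refl
setLabel-other {suc n} (c ▷ v , l₀) a l x x≢a with a ≟ n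
... | yes refl with x ≟ n
...   | yes x≡n = ⊥-elim (x≢a x≡n)
...   | no  _   = refl
setLabel-other {suc n} (c ▷ v , l₀) a l x x≢a | no _ with x ≟ n
...   | yes _ = refl
...   | no  _ = setLabel-other c a l x x≢a

setLabel-this : ∀ {n} (c : Cond n) a l → a < n → lab (setLabel c a l) a ≡ l
setLabel-this {suc n} (c ▷ v , l₀) a l a<sn with a ≟ n
... | yes refl = lab-last
  where
  lab-last : lab (c ▷ v , l) a ≡ l
  lab-last with a ≟ a
  ... | yes _   = refl
  ... | no  a≢a = ⊥-elim (a≢a refl)
... | no a≢n = trans (lab-earlier (setLabel c a l) v l₀ a a≢n) (setLabel-this c a l (≤∧≢⇒< (≤-pred a<sn) a≢n))

-- Labelling a with ⟨b , len⟩ keeps a condition valid: the label constrains no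
-- pair inside the condition.
relabel : Condition → ℕ → Bool → Condition
relabel (cond n c valid-c) a b = cond n (setLabel c a (b , n)) valid-relabelled
  where
  valid-relabelled : Valid (setLabel c a (b , n))
  valid-relabelled x y x<y y<n z≤y with x ≟ a
  ... | yes refl = ⊥-elim (<⇒≱ y<n (subst (λ l → proj₂ l ≤ y) (setLabel-this c x (b , n) (<-trans x<y y<n)) z≤y))
  ... | no  x≢a  = trans (setLabel-sig c a (b , n) x y)
                   (trans (valid-c x y x<y y<n (subst (λ l → proj₂ l ≤ y) lab-x z≤y)) (cong proj₁ (sym lab-x)))
    where
    lab-x : lab (setLabel c a (b , n)) x ≡ lab c x
    lab-x = setLabel-other c a (b , n) x x≢a

relabel-≼ : ∀ p a b → len p ≤ a → ∀ p' → p' ≼ p → relabel p' a b ≼ p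
relabel-≼ p a b len≤a (cond n c _) (len≤ , sig≡ , lab≡) = len≤ ,
  (λ x y x<y y< → trans (setLabel-sig c a _ x y) (sig≡ x y x<y y<)) ,
  (λ x x< → trans (setLabel-other c a _ x (λ x≡a → <⇒≱ x< (subst (len p ≤_) (sym x≡a) len≤a))) (lab≡ x x<))

relabel-lab : ∀ p a b → a < len p → lab (raw (relabel p a b)) a ≡ (b , len p)
relabel-lab (cond n c _) a b a<n = setLabel-this c a (b , n) a<n

relabel-sig : ∀ p a b x y → sig (raw (relabel p a b)) x y ≡ sig (raw p) x y
relabel-sig (cond n c _) a b x y = setLabel-sig c a (b , n) x y

-- The classes of conditions q such that a program e, relative to P, halts on
-- ⟨code q , ⟨a , b⟩⟩ for some a and all b are Σ⁰₃ relative to P.  The programs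
-- used below ignore b, so these classes are in fact Σ⁰₁.
HaltsSomewhere : (ℕ → Bool) → Code 1 → Condition → Set
HaltsSomewhere P e q = ∃[ a ] (∀ b → Halts (χ P) e (pair (code q) (pair a b)))

haltsSomewhere-Σ₃ : ∀ P e → Sigma3 P (HaltsSomewhere P e)
haltsSomewhere-Σ₃ P e = e , λ q → (λ w → w) , (λ w → w)

dist : ℕ → ℕ → ℕ
dist a b = (a ∸ b) + (b ∸ a)

dist≡0⇒≡ : ∀ a b → dist a b ≡ 0 → a ≡ b
dist≡0⇒≡ a b d≡0 = ≤-antisym (m∸n≡0⇒m≤n (m+n≡0⇒m≡0 (a ∸ b) d≡0)) (m∸n≡0⇒m≤n (m+n≡0⇒n≡0 (a ∸ b) d≡0))

dist-self : ∀ a → dist a a ≡ 0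
dist-self a rewrite n∸n≡0 a = refl

distₑ : ∀ {n} → Expr n → Expr n → Expr n
distₑ a b = (a ∸ₑ b) +ₑ (b ∸ₑ a)

cong₃ : ∀ (h : ℕ → ℕ → ℕ → ℕ) {x x' y y' z z'} → x ≡ x' → y ≡ y' → z ≡ z' → h x y z ≡ h x' y' z'
cong₃ h refl refl refl = refl

codeOfₑ pointOfₑ lenOfₑ labelOfₑ : ∀ {n} → Expr n → Expr n
codeOfₑ e  = fstₑ e
pointOfₑ e = fstₑ (sndₑ e)
lenOfₑ e   = fstₑ (codeOfₑ e)
labelOfₑ e = labₑ (sndₑ (codeOfₑ e)) (lenOfₑ e) (pointOfₑ e)

module _ {g : ℕ → ℕ} {n : ℕ} (e : Expr n) (xs : Vec ℕ n) (q : Condition) (a b : ℕ)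
         (query : ⟦ e ⟧ g xs ≡ pair (code q) (pair a b)) where

  codeOf-eval : ⟦ codeOfₑ e ⟧ g xs ≡ code q
  codeOf-eval = trans (fstₑ-eval e xs) (trans (cong π₁ query) (π₁-pair (code q) (pair a b)))

  pointOf-eval : ⟦ pointOfₑ e ⟧ g xs ≡ a
  pointOf-eval = begin
    ⟦ pointOfₑ e ⟧ g xs                 ≡⟨ fstₑ-eval (sndₑ e) xs ⟩
    π₁ (⟦ sndₑ e ⟧ g xs)                ≡⟨ cong π₁ (sndₑ-eval e xs) ⟩
    π₁ (π₂ (⟦ e ⟧ g xs))                ≡⟨ cong (λ w → π₁ (π₂ w)) query ⟩
    π₁ (π₂ (pair (code q) (pair a b)))  ≡⟨ cong π₁ (π₂-pair (code q) (pair a b)) ⟩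
    π₁ (pair a b)                       ≡⟨ π₁-pair a b ⟩
    a                                   ∎
    where open ≡-Reasoning

  lenOf-eval : ⟦ lenOfₑ e ⟧ g xs ≡ len q
  lenOf-eval = trans (fstₑ-eval (codeOfₑ e) xs) (trans (cong π₁ codeOf-eval) (π₁-pair (len q) (codeCond (raw q))))

  condOf-eval : ⟦ sndₑ (codeOfₑ e) ⟧ g xs ≡ codeCond (raw q)
  condOf-eval = trans (sndₑ-eval (codeOfₑ e) xs) (trans (cong π₂ codeOf-eval) (π₂-pair (len q) (codeCond (raw q))))

  labelOf-eval : ⟦ labelOfₑ e ⟧ g xs ≡ labCode (codeCond (raw q)) (len q) a
  labelOf-eval = trans (labₑ-eval (sndₑ (codeOfₑ e)) (lenOfₑ e) (pointOfₑ e) xs)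
    (cong₃ labCode condOf-eval lenOf-eval pointOf-eval)

longProgram : ℕ → Code 1
longProgram N = guarded (lit 0) (lit N ∸ₑ lenOfₑ v₀)

module _ (g : ℕ → ℕ) (N : ℕ) (q : Condition) (a b : ℕ) where
  private
    query : ℕ
    query = pair (code q) (pair a b)
    gap : ⟦ lit N ∸ₑ lenOfₑ v₀ ⟧ g (query ∷ []) ≡ N ∸ len q
    gap = cong (N ∸_) (lenOf-eval {g} v₀ (query ∷ []) q a b refl)

  long-sound : Halts g (longProgram N) query → N ≤ len q
  long-sound (_ , run) = m∸n≡0⇒m≤n (trans (sym gap) (proj₁ (guarded-halts {g} (lit 0) (lit N ∸ₑ lenOfₑ v₀) (query ∷ []) run)))

  long-complete : N ≤ len q → Halts g (longProgram N) query
  long-complete N≤len = 0 , guarded-eval {g} (lit 0) (lit N ∸ₑ lenOfₑ v₀) (query ∷ []) (trans gap (m≤n⇒m∸n≡0 N≤len))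

record Witness (g : ℕ → ℕ) (R : Code 2) (t : ℕ) (q : Condition) (a : ℕ) : Set where
  field
    accepts  : Eval g R (a + a ∷ code q ∷ []) 1
    inside   : a < len q
    labelled : labCode (codeCond (raw q)) (len q) a ≡ t

-- On (r , query) the test vanishes iff r = 1, a < len q and the label of a
-- is t; the witness program runs R on (2a , code q) and tests its output r.
witnessTestₑ : ℕ → Expr 2
witnessTestₑ t = distₑ v₀ (lit 1) +ₑ ((lit 1 +ₑ pointOfₑ v₁) ∸ₑ lenOfₑ v₁) +ₑ distₑ (labelOfₑ v₁) (lit t)

doubleₑ : Expr 1
doubleₑ = pointOfₑ v₀ +ₑ pointOfₑ v₀

witnessProgram : Code 2 → ℕ → Code 1
witnessProgram R t = Comp (guarded (lit 0) (witnessTestₑ t))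
                          (Comp R (compile doubleₑ ∷ compile (codeOfₑ v₀) ∷ []) ∷ Proj zero ∷ [])

module _ (g : ℕ → ℕ) (R : Code 2) (t : ℕ) (q : Condition) (a b : ℕ) where
  private
    query : ℕ
    query = pair (code q) (pair a b)

  double-eval : ⟦ doubleₑ ⟧ g (query ∷ []) ≡ a + a
  double-eval = cong₂ _+_ (pointOf-eval {g} v₀ (query ∷ []) q a b refl) (pointOf-eval {g} v₀ (query ∷ []) q a b refl)

  witnessTest-eval : ∀ r → ⟦ witnessTestₑ t ⟧ g (r ∷ query ∷ []) ≡
                     dist r 1 + (suc a ∸ len q) + dist (labCode (codeCond (raw q)) (len q) a) t
  witnessTest-eval r = cong₂ (λ x y → dist r 1 + x + y)
    (cong₂ (λ p l → suc p ∸ l) (pointOf-eval {g} v₁ (r ∷ query ∷ []) q a b refl)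
                               (lenOf-eval {g} v₁ (r ∷ query ∷ []) q a b refl))
    (cong (λ l → dist l t) (labelOf-eval {g} v₁ (r ∷ query ∷ []) q a b refl))

  witness-sound : Halts g (witnessProgram R t) query → Witness g R t q a
  witness-sound (_ , eComp {ys = r ∷ _ ∷ []} (eComp {ys = d ∷ k ∷ []} (e-double ∷ e-code ∷ []) accept ∷ eProj ∷ []) check) =
    record { accepts = accepts ; inside = inside ; labelled = labelled }
    where
    lb : ℕ
    lb = labCode (codeCond (raw q)) (len q) a
    all≡0 : dist r 1 + (suc a ∸ len q) + dist lb t ≡ 0
    all≡0 = trans (sym (witnessTest-eval r)) (proj₁ (guarded-halts {g} (lit 0) (witnessTestₑ t) (r ∷ query ∷ []) check))
    first-two≡0 : dist r 1 + (suc a ∸ len q) ≡ 0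
    first-two≡0 = m+n≡0⇒m≡0 (dist r 1 + (suc a ∸ len q)) all≡0
    inside : a < len q
    inside = m∸n≡0⇒m≤n (m+n≡0⇒n≡0 (dist r 1) first-two≡0)
    labelled : lb ≡ t
    labelled = dist≡0⇒≡ lb t (m+n≡0⇒n≡0 (dist r 1 + (suc a ∸ len q)) all≡0)
    accepts : Eval g R (a + a ∷ code q ∷ []) 1
    accepts = subst₂ (λ m c → Eval g R (m ∷ c ∷ []) 1)
                (trans (eval-det e-double (compile-eval doubleₑ (query ∷ []))) double-eval)
                (trans (eval-det e-code (compile-eval (codeOfₑ v₀) (query ∷ []))) (codeOf-eval {g} v₀ (query ∷ []) q a b refl))
                (subst (Eval g R (d ∷ k ∷ [])) (dist≡0⇒≡ r 1 (m+n≡0⇒m≡0 (dist r 1) first-two≡0)) accept)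

  witness-complete : Witness g R t q a → Halts g (witnessProgram R t) query
  witness-complete w = 0 , eComp (eComp (compile-eval doubleₑ (query ∷ []) ∷ compile-eval (codeOfₑ v₀) (query ∷ []) ∷ []) accepts'
                                   ∷ eProj ∷ [])
                                 (guarded-eval {g} (lit 0) (witnessTestₑ t) (1 ∷ query ∷ []) all≡0)
    where
    open Witness w
    accepts' : Eval g R (⟦ doubleₑ ⟧ g (query ∷ []) ∷ ⟦ codeOfₑ v₀ ⟧ g (query ∷ []) ∷ []) 1
    accepts' = subst₂ (λ m c → Eval g R (m ∷ c ∷ []) 1) (sym double-eval)
                      (sym (codeOf-eval {g} v₀ (query ∷ []) q a b refl)) accepts
    all≡0 : ⟦ witnessTestₑ t ⟧ g (1 ∷ query ∷ []) ≡ 0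
    all≡0 = trans (witnessTest-eval 1)
      (cong₂ _+_ (m≤n⇒m∸n≡0 inside) (trans (cong (λ l → dist l t) labelled) (dist-self t)))

b2n-injective : ∀ {a b} → b2n a ≡ b2n b → a ≡ b
b2n-injective {false} {false} _ = refl
b2n-injective {true}  {true}  _ = refl

module GenericSequence (P : ℕ → Bool) (ps : ℕ → Condition)
                       (desc : Descending ps) (gen : ThreeGeneric P ps) where

  descending-≼ : ∀ s t → s ≤ t → ps t ≼ ps s
  descending-≼ s t s≤t = subst (λ u → ps u ≼ ps s) (m∸n+n≡m s≤t) (below (t ∸ s))
    where
    below : ∀ d → ps (d + s) ≼ ps s
    below zero    = ≼-refl (ps s)
    below (suc d) = ≼-trans {ps (suc (d + s))} {ps (d + s)} {ps s} (desc (d + s)) (below d)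

  -- The lengths are unbounded: the conditions of length ≥ N are met, since
  -- every condition can be lengthened.
  arbitrarily-long : ∀ N s → ∃[ t ] (s ≤ t × N ≤ len (ps t))
  arbitrarily-long N s with gen (HaltsSomewhere P (longProgram N)) (haltsSomewhere-Σ₃ P (longProgram N))
  ... | inj₁ (s' , a , halts) = s ⊔ s' , m≤m⊔n s s' ,
        ≤-trans (long-sound (χ P) N (ps s') a 0 (halts 0)) (proj₁ (descending-≼ s' (s ⊔ s') (m≤n⊔m s s')))
  ... | inj₂ (s' , avoids) with lengthen N (ps s')
  ...   | q , q≼ , N≤len = ⊥-elim (avoids q q≼ (0 , λ b → long-complete (χ P) N q 0 b N≤len))

  labels-respected : ∀ f → ExtendsAll f ps → ∀ s a y → a < len (ps s) → a < y →
                     proj₂ (lab (raw (ps s)) a) ≤ y → f a y ≡ proj₁ (lab (raw (ps s)) a)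
  labels-respected f ext s a y a<len a<y z≤y with arbitrarily-long (suc y) s
  ... | u , s≤u , y<len = begin
    f a y                             ≡⟨ ext u a y a<y y<len ⟩
    sig (raw (ps u)) a y              ≡⟨ valid (ps u) a y a<y y<len (subst (λ l → proj₂ l ≤ y) (sym same-label) z≤y) ⟩
    proj₁ (lab (raw (ps u)) a)        ≡⟨ cong proj₁ same-label ⟩
    proj₁ (lab (raw (ps s)) a)        ∎
    where
    open ≡-Reasoning
    same-label : lab (raw (ps u)) a ≡ lab (raw (ps s)) a
    same-label = proj₂ (proj₂ (descending-≼ s u s≤u)) a a<len

module Refutation (P : ℕ → Bool) (ps : ℕ → Condition) (f : ℕ → ℕ → Bool)
                  (desc : Descending ps) (gen : ThreeGeneric P ps) (ext : ExtendsAll f ps)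
                  (H : ℕ → Bool) (left-infinite : Infinite (HL H)) (right-infinite : Infinite (HR H))
                  (i : Bool) (homogeneous : ∀ x y → HL H x ≡ true → HR H y ≡ true → x ≢ y → fsym f x y ≡ i)
                  (c : Code 1) (computes : ∀ n → Eval (join (fSet f) (χ P)) c (n ∷ []) (χ H n)) where

  open GenericSequence P ps desc gen
  open Relativise finiteOracle

  G : ℕ → ℕ
  G = join (fSet f) (χ P)

  -- c run on the finite approximation of f ⊕ P given by a condition code
  R : Code 2
  R = relativise c

  -- witnesses carry labels of the colour opposite to that of H
  colour : ℕ
  colour = b2n (not i)

  Witnessed : Condition → Set
  Witnessed = HaltsSomewhere P (witnessProgram R colour)

  -- A point of H_L carrying a label of colour not i in some p_s contradicts
  -- homogeneity: the label forces f(a , y) = not i for all large y, and some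
  -- such y lies in H_R.
  left-labels : ∀ s a → a < len (ps s) → HL H a ≡ true → proj₁ (lab (raw (ps s)) a) ≢ not i
  left-labels s a a<len a-left label-colour = refute (right-infinite (suc (a ⊔ z)))
    where
    z : ℕ
    z = proj₂ (lab (raw (ps s)) a)
    refute : ∃[ y ] (suc (a ⊔ z) ≤ y × HR H y ≡ true) → ⊥
    refute (y , a⊔z<y , y-right) = not-¬ refl (sym (trans (sym forced) homogeneous-colour))
      where
      a<y : a < y
      a<y = ≤-<-trans (m≤m⊔n a z) a⊔z<y
      forced : f a y ≡ not i
      forced = trans (labels-respected f ext s a y a<len a<y (<⇒≤ (≤-<-trans (m≤n⊔m a z) a⊔z<y))) label-colour
      homogeneous-colour : f a y ≡ i
      homogeneous-colour = trans (sym (fsym-< f a<y)) (homogeneous a y a-left y-right (<⇒≢ a<y))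

  -- Meeting is impossible: a witness in p_s is a point of H_L labelled not i.
  not-met : ∀ s → ¬ Witnessed (ps s)
  not-met s (a , halts) = left-labels s a inside a-left label-colour
    where
    open Witness (witness-sound (χ P) R colour (ps s) a 0 (halts 0))
    accepted : Eval G c (a + a ∷ []) 1
    accepted = Soundness.sound (χ P) G (code (ps s)) (finiteOracle-sound (χ P) f (ps s) (ext s)) c accepts (a + a ∷ []) refl
    a-left : HL H a ≡ true
    a-left = b2n-injective (eval-det (computes (a + a)) accepted)
    label-colour : proj₁ (lab (raw (ps s)) a) ≡ not i
    label-colour = b2n-injective (trans (sym (labCode-correct (raw (ps s)) a inside)) labelled)

  left-accepted : ∀ a → HL H a ≡ true → Eval G c (a + a ∷ []) 1
  left-accepted a a-left = subst (Eval G c (a + a ∷ [])) (cong b2n a-left) (computes (a + a))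

  -- A point a of H_L outside p_s is a witness for some extension of p_s: the
  -- computation putting a into H_L uses only a finite part of f ⊕ P, so a long
  -- enough extension of p_s, relabelled at a with not i, has the witness a.
  witnessed-extension : ∀ s a → len (ps s) ≤ a → HL H a ≡ true → ∃[ q ] (q ≼ ps s × Witnessed q)
  witnessed-extension s a len≤a a-left = q , q≼ , (a , λ b → witness-complete (χ P) R colour q a b witness)
    where
    open Use (χ P) G
    N : ℕ
    N = proj₁ (use (left-accepted a a-left))
    simulate : ∀ k → AnswersBelow k N → Eval (χ P) R (a + a ∷ k ∷ []) 1
    simulate = proj₂ (use (left-accepted a a-left))
    long : ∃[ u ] (s ≤ u × suc (N ⊔ a) ≤ len (ps u))
    long = arbitrarily-long (suc (N ⊔ a)) s
    u : ℕ
    u = proj₁ long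
    q : Condition
    q = relabel (ps u) a (not i)
    q≼ : q ≼ ps s
    q≼ = relabel-≼ (ps s) a (not i) len≤a (ps u) (descending-≼ s u (proj₁ (proj₂ long)))
    N⊔a<len : N ⊔ a < len q
    N⊔a<len = proj₂ (proj₂ long)
    a<len : a < len q
    a<len = ≤-<-trans (m≤n⊔m N a) N⊔a<len
    agrees : Agrees f q
    agrees x y x<y y<len = trans (ext u x y x<y y<len) (sym (relabel-sig (ps u) a (not i) x y))
    witness : Witness (χ P) R colour q a
    witness = record
      { accepts  = simulate (code q) (λ m m<N → finiteOracle-complete (χ P) f q agrees m
                                                   (<-≤-trans m<N (≤-trans (m≤m⊔n N a) (<⇒≤ N⊔a<len))))
      ; inside   = a<len
      ; labelled = trans (labCode-correct (raw q) a a<len) (cong (λ l → b2n (proj₁ l)) (relabel-lab (ps u) a (not i) a<len))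
      }

  -- Avoiding is impossible: H_L has points beyond every p_s.
  not-avoided : ∀ s → ¬ (∀ q → q ≼ ps s → ¬ Witnessed q)
  not-avoided s avoids = avoids q q≼ witnessed
    where
    point : ∃[ a ] (len (ps s) ≤ a × HL H a ≡ true)
    point = left-infinite (len (ps s))
    extension : ∃[ q ] (q ≼ ps s × Witnessed q)
    extension = witnessed-extension s (proj₁ point) (proj₁ (proj₂ point)) (proj₂ (proj₂ point))
    q : Condition
    q = proj₁ extension
    q≼ : q ≼ ps s
    q≼ = proj₁ (proj₂ extension)
    witnessed : Witnessed q
    witnessed = proj₂ (proj₂ extension)

  impossible : ⊥
  impossible with gen Witnessed (haltsSomewhere-Σ₃ P (witnessProgram R colour))
  ... | inj₁ (s , met)    = not-met s met
  ... | inj₂ (s , avoids) = not-avoided s avoids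

lemma4p2 : (P : ℕ → Bool) (ps : ℕ → Condition) (f : ℕ → ℕ → Bool) →
           Descending ps → ThreeGeneric P ps → ExtendsAll f ps →
           ¬ (∃[ H ] (PHomogeneous f H × (H ≤T join (fSet f) (χ P))))
lemma4p2 P ps f desc gen ext (H , (left-infinite , right-infinite , i , homogeneous) , (c , computes)) =
  Refutation.impossible P ps f desc gen ext H left-infinite right-infinite i homogeneous c computes
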